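{- For all negative integers $n,m,k$, $\sum_{j\in\{ -1,-2,\dots,k+1\}} q^{(k-j)(n-j)}\binom{n}{j}_q\binom{m}{k-j}_q = \binom{n+m}{k}_q,$ where the sum is empty (hence $0$) when $k=-1$.
   Context: For an integer $n\ge 0$, $(a;q)_n=\prod_{j=0}^{n-1}(1-aq^j)$, and for $n<0$, $(a;q)_n=\prod_{j=1}^{|n|}\frac{1}{1-aq^{ -j}}$. For all integers $n,k$, $\binom{n}{k}_q := \lim_{a\to q} \frac{(a;q)_n}{(a;q)_k\,(a;q)_{n-k}}$ (a Laurent polynomial in $q$). -}

module Defs where

open import Data.Nat as ℕ using (ℕ; zero; suc)
open import Data.Integer as ℤ using (ℤ; +_; -[1+_]; 0ℤ; 1ℤ)
open import Data.List using (List; []; _∷_; map; replicate; _++_)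
open import Data.List.Relation.Unary.All using (All)
open import Data.Bool using (Bool; true; false; if_then_else_)
open import Relation.Nullary using (does)
open import Relation.Binary.PropositionalEquality using (_≡_)

-- Polynomials in q over ℤ : coefficient lists, lowest degree first.

Poly : Set
Poly = List ℤ

infixl 6 _+P_
infixl 7 _*P_

_+P_ : Poly → Poly → Poly
[]      +P q       = q
(a ∷ p) +P []      = a ∷ p
(a ∷ p) +P (b ∷ q) = (a ℤ.+ b) ∷ (p +P q)

negP : Poly → Poly
negP = map (λ x → ℤ.- x)

_*P_ : Poly → Poly → Poly
[]      *P q = []
(a ∷ p) *P q = map (a ℤ.*_) q +P (0ℤ ∷ (p *P q))

oneP : Poly
oneP = 1ℤ ∷ []

Xᵖ : ℕ → Poly
Xᵖ e = replicate e 0ℤ ++ (1ℤ ∷ [])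

IsZeroP : Poly → Set
IsZeroP p = All (_≡ 0ℤ) p

-- Rational functions in q over ℤ (fractions num/den; denominators used
-- below are always nonzero).  Laurent polynomials in q embed here.

record Frac : Set where
  constructor _/_
  field
    num : Poly
    den : Poly
open Frac public

infix 4 _≈F_
infixl 6 _+F_
infixl 7 _*F_

_≈F_ : Frac → Frac → Set
(p / q) ≈F (r / s) = IsZeroP ((p *P s) +P negP (r *P q))

_+F_ : Frac → Frac → Frac
(p / q) +F (r / s) = ((p *P s) +P (r *P q)) / (q *P s)

_*F_ : Frac → Frac → Frac
(p / q) *F (r / s) = (p *P r) / (q *P s)

invF : Frac → Frac
invF (p / q) = q / p

0F 1F : Frac
0F = [] / oneP
1F = oneP / oneP

fromPoly : Poly → Frac
fromPoly p = p / oneP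

qpow : ℤ → Frac
qpow (+ e)     = fromPoly (Xᵖ e)
qpow -[1+ e ]  = oneP / Xᵖ (suc e)

-- q-binomial coefficient for all integers n, k, as the limit a → q of
--   (a;q)_n / ((a;q)_k (a;q)_{n-k}).
-- At a = q, (a;q)_n has a simple pole (factor 1/(1 - a q^{-1})) exactly
-- when n < 0 and is regular nonzero otherwise.  Writing
--   (a;q)_n = (1 - a/q)^{-pole n} · r_n(a)   with r_n(q) = reg n,
-- the limit is reg n / (reg k · reg (n-k)) if the pole orders balance,
-- and 0 otherwise (the denominator then has the higher pole order).

pole : ℤ → ℕ
pole (+ _)     = 0
pole -[1+ _ ]  = 1

posProd : ℕ → Frac
posProd zero    = 1F
posProd (suc n) = posProd n *F fromPoly (oneP +P negP (Xᵖ (suc n)))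

negProd : ℕ → Frac
negProd zero    = 1F
negProd (suc N) = negProd N *F ((Xᵖ (suc N) +P negP oneP) / Xᵖ (suc N))

-- reg n = value at a = q of the regular part of (a;q)_n :
--   n ≥ 0 : (q;q)_n = ∏_{j=0}^{n-1}(1 - q^{j+1})
--   n = -(N+1) : 1 / ∏_{j=2}^{N+1} (1 - q^{1-j})
reg : ℤ → Frac
reg (+ n)     = posProd n
reg -[1+ N ]  = invF (negProd N)

qbinom : ℤ → ℤ → Frac
qbinom n k =
  if does (pole n ℕ.≟ (pole k ℕ.+ pole (n ℤ.- k)))
  then reg n *F invF (reg k *F reg (n ℤ.- k))
  else 0F

sumF : ℕ → (ℕ → Frac) → Frac
sumF zero    f = 0F
sumF (suc c) f = sumF c f +F f c

module Submission where

-- Write B b N for the q-binomial coefficient with n = -(b+1) and k = -(N+1).  It vanishes for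
-- N < b and equals (q⁻¹;q⁻¹)_N / ((q⁻¹;q⁻¹)_b (q;q)_k) for N = b + k.  This closed form yields
-- B 0 0 = 1, B (b+1) 0 = 0, B 0 (N+1) = -q^-(N+1) B 0 N and the Pascal rule
-- B (b+1) (N+1) = q^(b-N) (B b N - B (b+1) N), and these recurrences alone force the identity in
-- any commutative ring.  Induct on c = -k-1: the recurrence for B 0 or the Pascal rule, applied
-- to the second factor of a summand for c+1, writes it as q^K times summands for c, because the
-- weight (k-j)(n-j) shifts by exactly n-j when k decreases by one; the new last summand is the
-- boundary term, and the Pascal rule for the right-hand side closes the induction.  The closed
-- form is evaluated in the fraction field of ℤ[q], where the Laurent polynomials of the
-- statement live.

open import Defs
open import Data.Nat as ℕ using (ℕ; zero; suc; _∸_; _<_; s≤s; z≤n; compare; less; equal; greater)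
import Data.Nat.Properties as ℕP
open import Data.Integer as ℤ using (ℤ; +_; -[1+_]; _⊖_; 0ℤ; 1ℤ)
import Data.Integer.Properties as ℤP
open import Data.Integer.Tactic.RingSolver using () renaming (solve-∀ to solve-ℤ)
open import Data.List using ([]; _∷_; map)
open import Data.List.Relation.Unary.All using ([]; _∷_; all?)
open import Data.Bool using (if_then_else_; true; false)
open import Data.Maybe using (Maybe; just; nothing)
open import Data.Product using (_,_)
open import Data.Sum using (inj₁; inj₂)
open import Data.Empty using (⊥-elim)
open import Function using (_∘_)
open import Level using (0ℓ; _⊔_)
open import Relation.Nullary using (¬_; yes; no; does)
open import Relation.Binary.PropositionalEquality as ≡ using (_≡_; _≢_)
open import Relation.Binary.Bundles using (Setoid)
open import Algebra.Bundles using (CommutativeRing; CommutativeMonoid)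
open import Algebra.Structures using (IsCommutativeMonoid)
open import Algebra.Definitions using (AlmostRightCancellative)
import Algebra.Properties.Ring as RingProperties
import Algebra.Properties.AbelianGroup as AbelianGroupProperties
import Algebra.Properties.CommutativeSemigroup as CommutativeSemigroupProperties
import Algebra.Solver.CommutativeMonoid as CommutativeMonoidSolver
import Relation.Binary.Reasoning.Setoid as SetoidReasoning
open import Tactic.RingSolver using (solve-∀)
import Tactic.RingSolver.Core.AlmostCommutativeRing as ACR

module Sums {c ℓ} (R : CommutativeRing c ℓ) where
  open CommutativeRing R
  open SetoidReasoning setoid
  open AbelianGroupProperties +-abelianGroup using (ε⁻¹≈ε; ⁻¹-∙-comm)
  open CommutativeSemigroupProperties +-commutativeSemigroup using (interchange)

  ∑ : ℕ → (ℕ → Carrier) → Carrier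
  ∑ zero    f = 0#
  ∑ (suc n) f = ∑ n f + f n

  ∑-cong : ∀ n {f g} → (∀ i → i < n → f i ≈ g i) → ∑ n f ≈ ∑ n g
  ∑-cong zero    f≈g = refl
  ∑-cong (suc n) f≈g = +-cong (∑-cong n λ i i<n → f≈g i (ℕP.m<n⇒m<1+n i<n)) (f≈g n ℕP.≤-refl)

  ∑-*ˡ : ∀ n k f → ∑ n (λ i → k * f i) ≈ k * ∑ n f
  ∑-*ˡ zero    k f = sym (zeroʳ k)
  ∑-*ˡ (suc n) k f = begin
    ∑ n (λ i → k * f i) + k * f n  ≈⟨ +-congʳ (∑-*ˡ n k f) ⟩
    k * ∑ n f + k * f n            ≈⟨ distribˡ k (∑ n f) (f n) ⟨
    k * (∑ n f + f n)              ∎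

  ∑-neg : ∀ n f → ∑ n (λ i → - f i) ≈ - ∑ n f
  ∑-neg zero    f = sym ε⁻¹≈ε
  ∑-neg (suc n) f = begin
    ∑ n (λ i → - f i) + - f n  ≈⟨ +-congʳ (∑-neg n f) ⟩
    - ∑ n f + - f n            ≈⟨ ⁻¹-∙-comm (∑ n f) (f n) ⟩
    - (∑ n f + f n)            ∎

  ∑-+ : ∀ n f g → ∑ n (λ i → f i + g i) ≈ ∑ n f + ∑ n g
  ∑-+ zero    f g = sym (+-identityˡ 0#)
  ∑-+ (suc n) f g = begin
    ∑ n (λ i → f i + g i) + (f n + g n)  ≈⟨ +-congʳ (∑-+ n f g) ⟩
    (∑ n f + ∑ n g) + (f n + g n)        ≈⟨ interchange (∑ n f) (∑ n g) (f n) (g n) ⟩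
    (∑ n f + f n) + (∑ n g + g n)        ∎

  ∑-sub : ∀ n f g → ∑ n (λ i → f i - g i) ≈ ∑ n f - ∑ n g
  ∑-sub n f g = trans (∑-+ n f (λ i → - g i)) (+-congˡ (∑-neg n g))

module UnitIdentities {c ℓ} (R : CommutativeRing c ℓ) where
  open CommutativeRing R
  open SetoidReasoning setoid
  open RingProperties ring using (-‿distribˡ-*; -‿distribʳ-*; x[y-z]≈xy-xz)
  open CommutativeSemigroupProperties *-commutativeSemigroup using (x∙yz≈y∙xz)
  open CommutativeMonoidSolver *-commutativeMonoid using (solve; _⊜_; _⊕_)

  inverse-difference : ∀ {y y′ z z′} → y′ * y ≈ 1# → z′ * z ≈ 1# → (y′ * z′) * (y - z) ≈ z′ - y′
  inverse-difference {y} {y′} {z} {z′} y′y≈1 z′z≈1 = begin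
    (y′ * z′) * (y - z)                ≈⟨ x[y-z]≈xy-xz (y′ * z′) y z ⟩
    (y′ * z′) * y - (y′ * z′) * z      ≈⟨ +-cong (solve 3 (λ y′ z′ y → (y′ ⊕ z′) ⊕ y ⊜ z′ ⊕ (y′ ⊕ y)) refl y′ z′ y)
                                                 (-‿cong (*-assoc y′ z′ z)) ⟩
    z′ * (y′ * y) - y′ * (z′ * z)      ≈⟨ +-cong (*-congˡ y′y≈1) (-‿cong (*-congˡ z′z≈1)) ⟩
    z′ * 1# - y′ * 1#                  ≈⟨ +-cong (*-identityʳ z′) (-‿cong (*-identityʳ y′)) ⟩
    z′ - y′                            ∎

  -- With a = 1/(q⁻¹;q⁻¹)_b, m = (q⁻¹;q⁻¹)_(b+k+1), c = 1/(q;q)_k, the next factors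
  -- y = 1 - q^-(b+1), z = 1 - q^(k+1), Y = 1 - q^-(b+k+2) and t = q^-(k+1), this is the Pascal rule.
  pascal-units : ∀ {a m c y y′ z z′ t Y} → y′ * y ≈ 1# → z′ * z ≈ 1# → Y ≈ t * (y - z) →
                 (a * y′) * ((m * Y) * (c * z′)) ≈ t * (a * (m * (c * z′)) - (a * y′) * (m * c))
  pascal-units {a} {m} {c} {y} {y′} {z} {z′} {t} {Y} y′y≈1 z′z≈1 Y≈t[y-z] = begin
    (a * y′) * ((m * Y) * (c * z′))
      ≈⟨ solve 6 (λ a y′ m Y c z′ → (a ⊕ y′) ⊕ ((m ⊕ Y) ⊕ (c ⊕ z′)) ⊜ (a ⊕ (m ⊕ c)) ⊕ ((y′ ⊕ z′) ⊕ Y))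
                 refl a y′ m Y c z′ ⟩
    F * ((y′ * z′) * Y)
      ≈⟨ *-congˡ (*-congˡ Y≈t[y-z]) ⟩
    F * ((y′ * z′) * (t * (y - z)))
      ≈⟨ *-congˡ (x∙yz≈y∙xz (y′ * z′) t (y - z)) ⟩
    F * (t * ((y′ * z′) * (y - z)))
      ≈⟨ *-congˡ (*-congˡ (inverse-difference y′y≈1 z′z≈1)) ⟩
    F * (t * (z′ - y′))
      ≈⟨ x∙yz≈y∙xz F t (z′ - y′) ⟩
    t * (F * (z′ - y′))
      ≈⟨ *-congˡ (x[y-z]≈xy-xz F z′ y′) ⟩
    t * (F * z′ - F * y′)
      ≈⟨ *-congˡ (+-cong (solve 4 (λ a m c z′ → (a ⊕ (m ⊕ c)) ⊕ z′ ⊜ a ⊕ (m ⊕ (c ⊕ z′))) refl a m c z′)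
                         (-‿cong (solve 4 (λ a m c y′ → (a ⊕ (m ⊕ c)) ⊕ y′ ⊜ (a ⊕ y′) ⊕ (m ⊕ c)) refl a m c y′))) ⟩
    t * (a * (m * (c * z′)) - (a * y′) * (m * c))
      ∎
    where F = a * (m * c)

  -- The same computation for B 0 (N+1), with Y = 1 - q^-(N+1), z = 1 - q^(N+1) and t = q^-(N+1).
  pascal-zero-units : ∀ {a m c z z′ t Y} → z′ * z ≈ 1# → Y ≈ - (t * z) →
                      a * ((m * Y) * (c * z′)) ≈ - (t * (a * (m * c)))
  pascal-zero-units {a} {m} {c} {z} {z′} {t} {Y} z′z≈1 Y≈-tz = begin
    a * ((m * Y) * (c * z′))
      ≈⟨ solve 5 (λ a m Y c z′ → a ⊕ ((m ⊕ Y) ⊕ (c ⊕ z′)) ⊜ (a ⊕ (m ⊕ c)) ⊕ (Y ⊕ z′)) refl a m Y c z′ ⟩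
    F * (Y * z′)             ≈⟨ *-congˡ (*-congʳ Y≈-tz) ⟩
    F * (- (t * z) * z′)     ≈⟨ *-congˡ (-‿distribˡ-* (t * z) z′) ⟨
    F * - ((t * z) * z′)     ≈⟨ *-congˡ (-‿cong (trans (*-assoc t z z′) (*-congˡ (trans (*-comm z z′) z′z≈1)))) ⟩
    F * - (t * 1#)           ≈⟨ *-congˡ (-‿cong (*-identityʳ t)) ⟩
    F * - t                  ≈⟨ -‿distribʳ-* F t ⟨
    - (F * t)                ≈⟨ -‿cong (*-comm F t) ⟩
    - (t * F)                ∎
    where F = a * (m * c)

-[1+m]-[-[1+n]]≡n-m : ∀ m n → -[1+ m ] ℤ.- -[1+ n ] ≡ + n ℤ.- + m
-[1+m]-[-[1+n]]≡n-m m n = ≡.trans (ℤP.[1+m]⊖[1+n]≡m⊖n n m) (≡.sym (ℤP.m-n≡m⊖n n m))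

weight : ℕ → ℕ → ℕ → ℤ
weight a c i = (-[1+ c ] ℤ.- -[1+ i ]) ℤ.* (-[1+ a ] ℤ.- -[1+ i ])

module Weight where
  open ≡.≡-Reasoning
  open import Data.Integer using (_+_; _-_; _*_; -_)

  weight≡ : ∀ a c i → weight a c i ≡ (+ i - + c) * (+ i - + a)
  weight≡ a c i = ≡.cong₂ _*_ (-[1+m]-[-[1+n]]≡n-m c i) (-[1+m]-[-[1+n]]≡n-m a i)

  weight-last : ∀ a c → weight a (suc c) c ≡ a ⊖ c
  weight-last a c = begin
    weight a (suc c) c                   ≡⟨ weight≡ a (suc c) c ⟩
    (+ c - (1ℤ + + c)) * (+ c - + a)     ≡⟨ identity (+ a) (+ c) ⟩
    + a - + c                            ≡⟨ ℤP.m-n≡m⊖n a c ⟩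
    a ⊖ c                                ∎
    where
    identity : ∀ A C → (C - (1ℤ + C)) * (C - A) ≡ A - C
    identity = solve-ℤ

  weight-shift : ∀ a c i K → weight a (suc c) i + (K + (+ i - + a)) ≡ K + weight a c i
  weight-shift a c i K = begin
    weight a (suc c) i + (K + (+ i - + a))                  ≡⟨ ≡.cong (_+ (K + (+ i - + a))) (weight≡ a (suc c) i) ⟩
    (+ i - (1ℤ + + c)) * (+ i - + a) + (K + (+ i - + a))    ≡⟨ identity (+ a) (+ c) (+ i) K ⟩
    K + (+ i - + c) * (+ i - + a)                           ≡⟨ ≡.cong (_+_ K) (weight≡ a c i) ⟨
    K + weight a c i                                        ∎
    where
    identity : ∀ A C I K → (I - (1ℤ + C)) * (I - A) + (K + (I - A)) ≡ K + (I - C) * (I - A)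
    identity = solve-ℤ

  exponent-zero : ∀ a i j → -[1+ j ] ≡ (a ⊖ suc (i ℕ.+ j)) + (+ i - + a)
  exponent-zero a i j = begin
    -[1+ j ]                                         ≡⟨ identity (+ a) (+ i) (+ j) ⟩
    (+ a - + suc (i ℕ.+ j)) + (+ i - + a)            ≡⟨ ≡.cong (_+ (+ i - + a)) (ℤP.m-n≡m⊖n a (suc (i ℕ.+ j))) ⟩
    (a ⊖ suc (i ℕ.+ j)) + (+ i - + a)                ∎
    where
    identity : ∀ A I J → - (1ℤ + J) ≡ (A - (1ℤ + (I + J))) + (I - A)
    identity = solve-ℤ

  exponent-suc : ∀ a b i j → b ⊖ j ≡ (suc (a ℕ.+ b) ⊖ suc (i ℕ.+ j)) + (+ i - + a)
  exponent-suc a b i j = begin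
    b ⊖ j
      ≡⟨ ℤP.m-n≡m⊖n b j ⟨
    + b - + j
      ≡⟨ identity (+ a) (+ b) (+ i) (+ j) ⟩
    (+ suc (a ℕ.+ b) - + suc (i ℕ.+ j)) + (+ i - + a)
      ≡⟨ ≡.cong (_+ (+ i - + a)) (ℤP.m-n≡m⊖n (suc (a ℕ.+ b)) (suc (i ℕ.+ j))) ⟩
    (suc (a ℕ.+ b) ⊖ suc (i ℕ.+ j)) + (+ i - + a)
      ∎
    where
    identity : ∀ A B I J → B - J ≡ ((1ℤ + (A + B)) - (1ℤ + (I + J))) + (I - A)
    identity = solve-ℤ

module _ {c ℓ} (R : CommutativeRing c ℓ) where
  open CommutativeRing R

  -- B b N stands for the q-binomial coefficient with n = -(b+1) and k = -(N+1).
  record NegativeQBinomial : Set (c ⊔ ℓ) where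
    field
      q^_         : ℤ → Carrier
      q^-homo     : ∀ e f → q^ (e ℤ.+ f) ≈ q^ e * q^ f
      B           : ℕ → ℕ → Carrier
      B-zero-zero : B 0 0 ≈ 1#
      B-suc-zero  : ∀ b → B (suc b) 0 ≈ 0#
      B-zero-suc  : ∀ N → B 0 (suc N) ≈ - (q^ -[1+ N ] * B 0 N)
      B-pascal    : ∀ b N → B (suc b) (suc N) ≈ q^ (b ⊖ N) * (B b N - B (suc b) N)

module NegativeVandermonde {c ℓ} {R : CommutativeRing c ℓ} (QB : NegativeQBinomial R) where
  open CommutativeRing R
  open NegativeQBinomial QB
  open Sums R
  open Weight
  open SetoidReasoning setoid
  open RingProperties ring using (-‿distribʳ-*; x[y-z]≈xy-xz)
  open CommutativeSemigroupProperties *-commutativeSemigroup using (interchange)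

  -- Summand i stands for j = -(i+1); the sums only use i < c, where c ∸ suc i is not truncated.
  term : ℕ → ℕ → ℕ → ℕ → Carrier
  term a b c i = q^ (weight a c i) * B a i * B b (c ∸ suc i)

  term-shift : ∀ a c i {e K y v} → e ≡ K ℤ.+ (+ i ℤ.- + a) → y ≈ q^ e * v →
               q^ (weight a (suc c) i) * B a i * y ≈ q^ K * (q^ (weight a c i) * B a i * v)
  term-shift a c i {e} {K} {y} {v} e≡K+i-a y≈q^e*v = begin
    q^ w′ * B a i * y            ≈⟨ *-congˡ y≈q^e*v ⟩
    q^ w′ * B a i * (q^ e * v)   ≈⟨ interchange (q^ w′) (B a i) (q^ e) v ⟩
    q^ w′ * q^ e * (B a i * v)   ≈⟨ *-congʳ (q^-homo w′ e) ⟨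
    q^ (w′ ℤ.+ e) * (B a i * v)  ≡⟨ ≡.cong (λ x → q^ x * (B a i * v)) w′+e≡K+w ⟩
    q^ (K ℤ.+ w) * (B a i * v)   ≈⟨ *-congʳ (q^-homo K w) ⟩
    q^ K * q^ w * (B a i * v)    ≈⟨ *-assoc (q^ K) (q^ w) (B a i * v) ⟩
    q^ K * (q^ w * (B a i * v))  ≈⟨ *-congˡ (*-assoc (q^ w) (B a i) v) ⟨
    q^ K * (q^ w * B a i * v)    ∎
    where
    w′ = weight a (suc c) i
    w  = weight a c i
    w′+e≡K+w : w′ ℤ.+ e ≡ K ℤ.+ w
    w′+e≡K+w = ≡.trans (≡.cong (ℤ._+_ w′) e≡K+i-a) (weight-shift a c i K)

  private
    suc[i+j]∸i≡suc[j] : ∀ i j → suc (i ℕ.+ j) ∸ i ≡ suc j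
    suc[i+j]∸i≡suc[j] i j = ≡.trans (≡.cong (_∸ i) (≡.sym (ℕP.+-suc i j))) (ℕP.m+n∸m≡n i (suc j))

  term-zero-step : ∀ a {c i} → i < c → term a 0 (suc c) i ≈ q^ (a ⊖ c) * - term a 0 c i
  term-zero-step a {c} {i} i<c with ℕP.m≤n⇒∃[o]m+o≡n i<c
  ... | j , ≡.refl = begin
    q^ w′ * B a i * B 0 (suc (i ℕ.+ j) ∸ i)
      ≡⟨ ≡.cong (λ n → q^ w′ * B a i * B 0 n) (suc[i+j]∸i≡suc[j] i j) ⟩
    q^ w′ * B a i * B 0 (suc j)
      ≈⟨ term-shift a c i (exponent-zero a i j) B-zero-suc′ ⟩
    q^ (a ⊖ c) * (q^ w * B a i * - B 0 j)
      ≈⟨ *-congˡ (-‿distribʳ-* (q^ w * B a i) (B 0 j)) ⟨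
    q^ (a ⊖ c) * - (q^ w * B a i * B 0 j)
      ≡⟨ ≡.cong (λ n → q^ (a ⊖ c) * - (q^ w * B a i * B 0 n)) (ℕP.m+n∸m≡n i j) ⟨
    q^ (a ⊖ c) * - (q^ w * B a i * B 0 (i ℕ.+ j ∸ i))
      ∎
    where
    w′ = weight a (suc c) i
    w  = weight a c i
    B-zero-suc′ : B 0 (suc j) ≈ q^ -[1+ j ] * - B 0 j
    B-zero-suc′ = trans (B-zero-suc j) (-‿distribʳ-* (q^ -[1+ j ]) (B 0 j))

  term-suc-step : ∀ a b {c i} → i < c →
                  term a (suc b) (suc c) i ≈ q^ (suc (a ℕ.+ b) ⊖ c) * (term a b c i - term a (suc b) c i)
  term-suc-step a b {c} {i} i<c with ℕP.m≤n⇒∃[o]m+o≡n i<c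
  ... | j , ≡.refl = begin
    q^ w′ * B a i * B (suc b) (suc (i ℕ.+ j) ∸ i)
      ≡⟨ ≡.cong (λ n → q^ w′ * B a i * B (suc b) n) (suc[i+j]∸i≡suc[j] i j) ⟩
    q^ w′ * B a i * B (suc b) (suc j)
      ≈⟨ term-shift a c i (exponent-suc a b i j) (B-pascal b j) ⟩
    q^ K * (q^ w * B a i * (B b j - B (suc b) j))
      ≈⟨ *-congˡ (x[y-z]≈xy-xz (q^ w * B a i) (B b j) (B (suc b) j)) ⟩
    q^ K * (q^ w * B a i * B b j - q^ w * B a i * B (suc b) j)
      ≡⟨ ≡.cong (λ n → q^ K * (q^ w * B a i * B b n - q^ w * B a i * B (suc b) n)) (ℕP.m+n∸m≡n i j) ⟨
    q^ K * (q^ w * B a i * B b (i ℕ.+ j ∸ i) - q^ w * B a i * B (suc b) (i ℕ.+ j ∸ i))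
      ∎
    where
    w′ = weight a (suc c) i
    w  = weight a c i
    K  = suc (a ℕ.+ b) ⊖ c

  term-zero-last : ∀ a c → term a 0 (suc c) c ≈ q^ (a ⊖ c) * B a c
  term-zero-last a c = begin
    q^ (weight a (suc c) c) * B a c * B 0 (c ∸ c)
      ≡⟨ ≡.cong₂ (λ e n → q^ e * B a c * B 0 n) (weight-last a c) (ℕP.n∸n≡0 c) ⟩
    q^ (a ⊖ c) * B a c * B 0 0  ≈⟨ *-congˡ B-zero-zero ⟩
    q^ (a ⊖ c) * B a c * 1#     ≈⟨ *-identityʳ (q^ (a ⊖ c) * B a c) ⟩
    q^ (a ⊖ c) * B a c          ∎

  term-suc-last : ∀ a b c → term a (suc b) (suc c) c ≈ 0#
  term-suc-last a b c = begin
    x * B (suc b) (c ∸ c)  ≡⟨ ≡.cong (λ n → x * B (suc b) n) (ℕP.n∸n≡0 c) ⟩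
    x * B (suc b) 0        ≈⟨ *-congˡ (B-suc-zero b) ⟩
    x * 0#                 ≈⟨ zeroʳ x ⟩
    0#                     ∎
    where x = q^ (weight a (suc c) c) * B a c

  vandermonde : ∀ a b c → ∑ c (term a b c) ≈ B (suc (a ℕ.+ b)) c
  vandermonde a b zero = sym (B-suc-zero (a ℕ.+ b))
  vandermonde a zero (suc c) = begin
    ∑ c (term a 0 (suc c)) + term a 0 (suc c) c
      ≈⟨ +-cong (∑-cong c λ i → term-zero-step a {c} {i}) (term-zero-last a c) ⟩
    ∑ c (λ i → k * - term a 0 c i) + k * B a c
      ≈⟨ +-congʳ (trans (∑-*ˡ c k (λ i → - term a 0 c i)) (*-congˡ (∑-neg c (term a 0 c)))) ⟩
    k * - ∑ c (term a 0 c) + k * B a c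
      ≈⟨ +-congʳ (*-congˡ (-‿cong (vandermonde a 0 c))) ⟩
    k * - B (suc (a ℕ.+ 0)) c + k * B a c
      ≡⟨ ≡.cong (λ n → k * - B (suc n) c + k * B a c) (ℕP.+-identityʳ a) ⟩
    k * - B (suc a) c + k * B a c
      ≈⟨ trans (distribˡ k (B a c) (- B (suc a) c)) (+-comm (k * B a c) (k * - B (suc a) c)) ⟨
    k * (B a c - B (suc a) c)
      ≈⟨ B-pascal a c ⟨
    B (suc a) (suc c)
      ≡⟨ ≡.cong (λ n → B (suc n) (suc c)) (ℕP.+-identityʳ a) ⟨
    B (suc (a ℕ.+ 0)) (suc c)
      ∎
    where k = q^ (a ⊖ c)
  vandermonde a (suc b) (suc c) = begin
    ∑ c (term a (suc b) (suc c)) + term a (suc b) (suc c) c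
      ≈⟨ +-cong (∑-cong c λ i → term-suc-step a b {c} {i}) (term-suc-last a b c) ⟩
    ∑ c (λ i → k * (term a b c i - term a (suc b) c i)) + 0#
      ≈⟨ +-identityʳ _ ⟩
    ∑ c (λ i → k * (term a b c i - term a (suc b) c i))
      ≈⟨ trans (∑-*ˡ c k _) (*-congˡ (∑-sub c (term a b c) (term a (suc b) c))) ⟩
    k * (∑ c (term a b c) - ∑ c (term a (suc b) c))
      ≈⟨ *-congˡ (+-cong (vandermonde a b c) (-‿cong (vandermonde a (suc b) c))) ⟩
    k * (B (suc (a ℕ.+ b)) c - B (suc (a ℕ.+ suc b)) c)
      ≡⟨ ≡.cong (λ n → k * (B (suc (a ℕ.+ b)) c - B (suc n) c)) (ℕP.+-suc a b) ⟩
    k * (B (suc (a ℕ.+ b)) c - B (suc (suc (a ℕ.+ b))) c)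
      ≈⟨ B-pascal (suc (a ℕ.+ b)) c ⟨
    B (suc (suc (a ℕ.+ b))) (suc c)
      ≡⟨ ≡.cong (λ n → B (suc n) (suc c)) (ℕP.+-suc a b) ⟨
    B (suc (a ℕ.+ suc b)) (suc c)
      ∎
    where k = q^ (suc (a ℕ.+ b) ⊖ c)

module Polynomial where
  open import Data.Integer using (_+_; _*_; -_; _-_)

  coeff : Poly → ℕ → ℤ
  coeff []      _       = 0ℤ
  coeff (a ∷ p) zero    = a
  coeff (a ∷ p) (suc n) = coeff p n

  infix 4 _≐_
  record _≐_ (p r : Poly) : Set where
    constructor coeffwise
    field coeff-≡ : ∀ n → coeff p n ≡ coeff r n
  open _≐_ public

  ≐-setoid : Setoid 0ℓ 0ℓ
  ≐-setoid = record
    { Carrier       = Poly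
    ; _≈_           = _≐_
    ; isEquivalence = record
      { refl  = coeffwise λ _ → ≡.refl
      ; sym   = λ p≐r → coeffwise λ n → ≡.sym (coeff-≡ p≐r n)
      ; trans = λ p≐r r≐s → coeffwise λ n → ≡.trans (coeff-≡ p≐r n) (coeff-≡ r≐s n)
      }
    }

  open Setoid ≐-setoid public
    using () renaming (refl to ≐-refl; sym to ≐-sym; trans to ≐-trans; reflexive to ≐-reflexive)

  ∷-cong : ∀ {a b p r} → a ≡ b → p ≐ r → a ∷ p ≐ b ∷ r
  ∷-cong a≡b p≐r = coeffwise λ { zero → a≡b ; (suc n) → coeff-≡ p≐r n }

  zero∷-≐[] : ∀ {p} → p ≐ [] → 0ℤ ∷ p ≐ []
  zero∷-≐[] p≐[] = coeffwise λ { zero → ≡.refl ; (suc n) → coeff-≡ p≐[] n }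

  ∷≐[]⇒head≡0 : ∀ {a p} → a ∷ p ≐ [] → a ≡ 0ℤ
  ∷≐[]⇒head≡0 a∷p≐[] = coeff-≡ a∷p≐[] 0

  ∷≐[]⇒tail≐[] : ∀ {a p} → a ∷ p ≐ [] → p ≐ []
  ∷≐[]⇒tail≐[] a∷p≐[] = coeffwise λ n → coeff-≡ a∷p≐[] (suc n)

  IsZeroP⇒≐[] : ∀ {p} → IsZeroP p → p ≐ []
  IsZeroP⇒≐[] []             = ≐-refl
  IsZeroP⇒≐[] (≡.refl ∷ p≡0) = zero∷-≐[] (IsZeroP⇒≐[] p≡0)

  ≐[]⇒IsZeroP : ∀ {p} → p ≐ [] → IsZeroP p
  ≐[]⇒IsZeroP {[]}    _    = []
  ≐[]⇒IsZeroP {a ∷ p} p≐[] = ∷≐[]⇒head≡0 p≐[] ∷ ≐[]⇒IsZeroP (∷≐[]⇒tail≐[] p≐[])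

  coeff-+P : ∀ p r n → coeff (p +P r) n ≡ coeff p n + coeff r n
  coeff-+P []      r       n       = ≡.sym (ℤP.+-identityˡ (coeff r n))
  coeff-+P (a ∷ p) []      n       = ≡.sym (ℤP.+-identityʳ (coeff (a ∷ p) n))
  coeff-+P (a ∷ p) (b ∷ r) zero    = ≡.refl
  coeff-+P (a ∷ p) (b ∷ r) (suc n) = coeff-+P p r n

  coeff-negP : ∀ p n → coeff (negP p) n ≡ - coeff p n
  coeff-negP []      n       = ≡.refl
  coeff-negP (a ∷ p) zero    = ≡.refl
  coeff-negP (a ∷ p) (suc n) = coeff-negP p n

  coeff-scale : ∀ a p n → coeff (map (a *_) p) n ≡ a * coeff p n
  coeff-scale a []      n       = ≡.sym (ℤP.*-zeroʳ a)
  coeff-scale a (b ∷ p) zero    = ≡.refl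
  coeff-scale a (b ∷ p) (suc n) = coeff-scale a p n

  module _ where
    open ≡.≡-Reasoning

    +P-cong : ∀ {p p′ r r′} → p ≐ p′ → r ≐ r′ → p +P r ≐ p′ +P r′
    +P-cong {p} {p′} {r} {r′} p≐p′ r≐r′ = coeffwise λ n → begin
      coeff (p +P r) n           ≡⟨ coeff-+P p r n ⟩
      coeff p n + coeff r n      ≡⟨ ≡.cong₂ _+_ (coeff-≡ p≐p′ n) (coeff-≡ r≐r′ n) ⟩
      coeff p′ n + coeff r′ n    ≡⟨ coeff-+P p′ r′ n ⟨
      coeff (p′ +P r′) n         ∎

    +P-assoc : ∀ p r s → (p +P r) +P s ≐ p +P (r +P s)
    +P-assoc p r s = coeffwise λ n → begin
      coeff ((p +P r) +P s) n                ≡⟨ coeff-+P (p +P r) s n ⟩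
      coeff (p +P r) n + coeff s n           ≡⟨ ≡.cong (_+ coeff s n) (coeff-+P p r n) ⟩
      coeff p n + coeff r n + coeff s n      ≡⟨ ℤP.+-assoc (coeff p n) (coeff r n) (coeff s n) ⟩
      coeff p n + (coeff r n + coeff s n)    ≡⟨ ≡.cong (_+_ (coeff p n)) (coeff-+P r s n) ⟨
      coeff p n + coeff (r +P s) n           ≡⟨ coeff-+P p (r +P s) n ⟨
      coeff (p +P (r +P s)) n                ∎

    +P-comm : ∀ p r → p +P r ≐ r +P p
    +P-comm p r = coeffwise λ n → begin
      coeff (p +P r) n         ≡⟨ coeff-+P p r n ⟩
      coeff p n + coeff r n    ≡⟨ ℤP.+-comm (coeff p n) (coeff r n) ⟩
      coeff r n + coeff p n    ≡⟨ coeff-+P r p n ⟨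
      coeff (r +P p) n         ∎

    +P-identityʳ : ∀ p → p +P [] ≐ p
    +P-identityʳ p = coeffwise λ n → ≡.trans (coeff-+P p [] n) (ℤP.+-identityʳ (coeff p n))

    negP-cong : ∀ {p p′} → p ≐ p′ → negP p ≐ negP p′
    negP-cong {p} {p′} p≐p′ = coeffwise λ n → begin
      coeff (negP p) n     ≡⟨ coeff-negP p n ⟩
      - coeff p n          ≡⟨ ≡.cong -_ (coeff-≡ p≐p′ n) ⟩
      - coeff p′ n         ≡⟨ coeff-negP p′ n ⟨
      coeff (negP p′) n    ∎

    +P-inverseʳ : ∀ p → p +P negP p ≐ []
    +P-inverseʳ p = coeffwise λ n → begin
      coeff (p +P negP p) n             ≡⟨ coeff-+P p (negP p) n ⟩
      coeff p n + coeff (negP p) n      ≡⟨ ≡.cong (_+_ (coeff p n)) (coeff-negP p n) ⟩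
      coeff p n - coeff p n             ≡⟨ ℤP.+-inverseʳ (coeff p n) ⟩
      0ℤ                                ∎

    scale-cong : ∀ a {p p′} → p ≐ p′ → map (a *_) p ≐ map (a *_) p′
    scale-cong a {p} {p′} p≐p′ = coeffwise λ n → begin
      coeff (map (a *_) p) n     ≡⟨ coeff-scale a p n ⟩
      a * coeff p n              ≡⟨ ≡.cong (a *_) (coeff-≡ p≐p′ n) ⟩
      a * coeff p′ n             ≡⟨ coeff-scale a p′ n ⟨
      coeff (map (a *_) p′) n    ∎

    scale-distribʳ : ∀ a b p → map ((a + b) *_) p ≐ map (a *_) p +P map (b *_) p
    scale-distribʳ a b p = coeffwise λ n → begin
      coeff (map ((a + b) *_) p) n                       ≡⟨ coeff-scale (a + b) p n ⟩
      (a + b) * coeff p n                                ≡⟨ ℤP.*-distribʳ-+ (coeff p n) a b ⟩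
      a * coeff p n + b * coeff p n                      ≡⟨ ≡.cong₂ _+_ (coeff-scale a p n) (coeff-scale b p n) ⟨
      coeff (map (a *_) p) n + coeff (map (b *_) p) n    ≡⟨ coeff-+P (map (a *_) p) (map (b *_) p) n ⟨
      coeff (map (a *_) p +P map (b *_) p) n             ∎

    scale-distribˡ : ∀ a p r → map (a *_) (p +P r) ≐ map (a *_) p +P map (a *_) r
    scale-distribˡ a p r = coeffwise λ n → begin
      coeff (map (a *_) (p +P r)) n                      ≡⟨ coeff-scale a (p +P r) n ⟩
      a * coeff (p +P r) n                               ≡⟨ ≡.cong (a *_) (coeff-+P p r n) ⟩
      a * (coeff p n + coeff r n)                        ≡⟨ ℤP.*-distribˡ-+ a (coeff p n) (coeff r n) ⟩
      a * coeff p n + a * coeff r n                      ≡⟨ ≡.cong₂ _+_ (coeff-scale a p n) (coeff-scale a r n) ⟨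
      coeff (map (a *_) p) n + coeff (map (a *_) r) n    ≡⟨ coeff-+P (map (a *_) p) (map (a *_) r) n ⟨
      coeff (map (a *_) p +P map (a *_) r) n             ∎

    scale-assoc : ∀ a b p → map (a *_) (map (b *_) p) ≐ map ((a * b) *_) p
    scale-assoc a b p = coeffwise λ n → begin
      coeff (map (a *_) (map (b *_) p)) n    ≡⟨ coeff-scale a (map (b *_) p) n ⟩
      a * coeff (map (b *_) p) n             ≡⟨ ≡.cong (a *_) (coeff-scale b p n) ⟩
      a * (b * coeff p n)                    ≡⟨ ℤP.*-assoc a b (coeff p n) ⟨
      a * b * coeff p n                      ≡⟨ coeff-scale (a * b) p n ⟨
      coeff (map ((a * b) *_) p) n           ∎

    scale-zero : ∀ p → map (0ℤ *_) p ≐ []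
    scale-zero p = coeffwise (coeff-scale 0ℤ p)

    scale-one : ∀ p → map (1ℤ *_) p ≐ p
    scale-one p = coeffwise λ n → ≡.trans (coeff-scale 1ℤ p n) (ℤP.*-identityˡ (coeff p n))

  +P-isCommutativeMonoid : IsCommutativeMonoid _≐_ _+P_ []
  +P-isCommutativeMonoid = record
    { isMonoid = record
      { isSemigroup = record
        { isMagma = record { isEquivalence = Setoid.isEquivalence ≐-setoid ; ∙-cong = +P-cong }
        ; assoc   = +P-assoc
        }
      ; identity = (λ _ → ≐-refl) , +P-identityʳ
      }
    ; comm = +P-comm
    }

  +P-commutativeMonoid : CommutativeMonoid 0ℓ 0ℓ
  +P-commutativeMonoid = record { isCommutativeMonoid = +P-isCommutativeMonoid }

  open CommutativeSemigroupProperties (CommutativeMonoid.commutativeSemigroup +P-commutativeMonoid)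
    using () renaming (interchange to +P-interchange; x∙yz≈y∙xz to +P-left-comm)
  open SetoidReasoning ≐-setoid

  zero∷-*P : ∀ p r → (0ℤ ∷ p) *P r ≐ 0ℤ ∷ (p *P r)
  zero∷-*P p r = +P-cong (scale-zero r) ≐-refl

  *P-∷ʳ : ∀ p a r → p *P (a ∷ r) ≐ map (a *_) p +P (0ℤ ∷ (p *P r))
  *P-∷ʳ []      a r = ≐-sym (zero∷-≐[] ≐-refl)
  *P-∷ʳ (b ∷ p) a r = ∷-cong (≡.cong (_+ 0ℤ) (ℤP.*-comm b a)) (begin
    map (b *_) r +P p *P (a ∷ r)                         ≈⟨ +P-cong ≐-refl (*P-∷ʳ p a r) ⟩
    map (b *_) r +P (map (a *_) p +P (0ℤ ∷ (p *P r)))    ≈⟨ +P-left-comm (map (b *_) r) (map (a *_) p) _ ⟩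
    map (a *_) p +P (map (b *_) r +P (0ℤ ∷ (p *P r)))    ∎)

  *P-zeroʳ : ∀ p → p *P [] ≐ []
  *P-zeroʳ []      = ≐-refl
  *P-zeroʳ (a ∷ p) = zero∷-≐[] (*P-zeroʳ p)

  *P-congʳ : ∀ p {r r′} → r ≐ r′ → p *P r ≐ p *P r′
  *P-congʳ []      r≐r′ = ≐-refl
  *P-congʳ (a ∷ p) r≐r′ = +P-cong (scale-cong a r≐r′) (∷-cong ≡.refl (*P-congʳ p r≐r′))

  *P-comm : ∀ p r → p *P r ≐ r *P p
  *P-comm []      r = ≐-sym (*P-zeroʳ r)
  *P-comm (a ∷ p) r = begin
    map (a *_) r +P (0ℤ ∷ (p *P r))    ≈⟨ +P-cong ≐-refl (∷-cong ≡.refl (*P-comm p r)) ⟩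
    map (a *_) r +P (0ℤ ∷ (r *P p))    ≈⟨ *P-∷ʳ r a p ⟨
    r *P (a ∷ p)                       ∎

  *P-congˡ : ∀ {p p′} r → p ≐ p′ → p *P r ≐ p′ *P r
  *P-congˡ {p} {p′} r p≐p′ = begin
    p *P r     ≈⟨ *P-comm p r ⟩
    r *P p     ≈⟨ *P-congʳ r p≐p′ ⟩
    r *P p′    ≈⟨ *P-comm r p′ ⟩
    p′ *P r    ∎

  *P-distribʳ : ∀ s p r → (p +P r) *P s ≐ p *P s +P r *P s
  *P-distribʳ s []      r       = ≐-refl
  *P-distribʳ s (a ∷ p) []      = ≐-sym (+P-identityʳ ((a ∷ p) *P s))
  *P-distribʳ s (a ∷ p) (b ∷ r) = begin
    map ((a + b) *_) s +P (0ℤ ∷ ((p +P r) *P s))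
      ≈⟨ +P-cong (scale-distribʳ a b s) (∷-cong ≡.refl (*P-distribʳ s p r)) ⟩
    (map (a *_) s +P map (b *_) s) +P ((0ℤ ∷ (p *P s)) +P (0ℤ ∷ (r *P s)))
      ≈⟨ +P-interchange (map (a *_) s) (map (b *_) s) _ _ ⟩
    (map (a *_) s +P (0ℤ ∷ (p *P s))) +P (map (b *_) s +P (0ℤ ∷ (r *P s)))
      ∎

  *P-scaleˡ : ∀ a p r → map (a *_) p *P r ≐ map (a *_) (p *P r)
  *P-scaleˡ a []      r = ≐-refl
  *P-scaleˡ a (b ∷ p) r = begin
    map ((a * b) *_) r +P (0ℤ ∷ (map (a *_) p *P r))
      ≈⟨ +P-cong (≐-sym (scale-assoc a b r)) (∷-cong (≡.sym (ℤP.*-zeroʳ a)) (*P-scaleˡ a p r)) ⟩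
    map (a *_) (map (b *_) r) +P map (a *_) (0ℤ ∷ (p *P r))
      ≈⟨ scale-distribˡ a (map (b *_) r) (0ℤ ∷ (p *P r)) ⟨
    map (a *_) (map (b *_) r +P (0ℤ ∷ (p *P r)))
      ∎

  *P-assoc : ∀ p r s → (p *P r) *P s ≐ p *P (r *P s)
  *P-assoc []      r s = ≐-refl
  *P-assoc (a ∷ p) r s = begin
    (map (a *_) r +P (0ℤ ∷ (p *P r))) *P s           ≈⟨ *P-distribʳ s (map (a *_) r) (0ℤ ∷ (p *P r)) ⟩
    map (a *_) r *P s +P (0ℤ ∷ (p *P r)) *P s        ≈⟨ +P-cong (*P-scaleˡ a r s) (zero∷-*P (p *P r) s) ⟩
    map (a *_) (r *P s) +P (0ℤ ∷ ((p *P r) *P s))    ≈⟨ +P-cong ≐-refl (∷-cong ≡.refl (*P-assoc p r s)) ⟩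
    map (a *_) (r *P s) +P (0ℤ ∷ (p *P (r *P s)))    ∎

  *P-identityˡ : ∀ p → oneP *P p ≐ p
  *P-identityˡ p = begin
    map (1ℤ *_) p +P (0ℤ ∷ [])    ≈⟨ +P-cong (scale-one p) (zero∷-≐[] ≐-refl) ⟩
    p +P []                       ≈⟨ +P-identityʳ p ⟩
    p                             ∎

  *P-distribˡ : ∀ p r s → p *P (r +P s) ≐ p *P r +P p *P s
  *P-distribˡ p r s = begin
    p *P (r +P s)       ≈⟨ *P-comm p (r +P s) ⟩
    (r +P s) *P p       ≈⟨ *P-distribʳ p r s ⟩
    r *P p +P s *P p    ≈⟨ +P-cong (*P-comm r p) (*P-comm s p) ⟩
    p *P r +P p *P s    ∎

  polyRing : CommutativeRing 0ℓ 0ℓ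
  polyRing = record
    { Carrier = Poly ; _≈_ = _≐_ ; _+_ = _+P_ ; _*_ = _*P_ ; -_ = negP ; 0# = [] ; 1# = oneP
    ; isCommutativeRing = record
      { isRing = record
        { +-isAbelianGroup = record
          { isGroup = record
            { isMonoid = IsCommutativeMonoid.isMonoid +P-isCommutativeMonoid
            ; inverse  = (λ p → ≐-trans (+P-comm (negP p) p) (+P-inverseʳ p)) , +P-inverseʳ
            ; ⁻¹-cong  = negP-cong
            }
          ; comm = +P-comm
          }
        ; *-cong     = λ {p} {p′} {r} p≐p′ r≐r′ → ≐-trans (*P-congˡ r p≐p′) (*P-congʳ p′ r≐r′)
        ; *-assoc    = *P-assoc
        ; *-identity = *P-identityˡ , (λ p → ≐-trans (*P-comm p oneP) (*P-identityˡ p))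
        ; distrib    = *P-distribˡ , *P-distribʳ
        }
      ; *-comm = *P-comm
      }
    }

  module polyRing = CommutativeRing polyRing

  polySolverRing : ACR.AlmostCommutativeRing 0ℓ 0ℓ
  polySolverRing = ACR.fromCommutativeRing polyRing isZero?
    where
    isZero? : ∀ p → Maybe ([] ≐ p)
    isZero? p with all? (ℤ._≟ 0ℤ) p
    ... | yes p≡0 = just (≐-sym (IsZeroP⇒≐[] p≡0))
    ... | no  _   = nothing

  no-zero-divisors-∷ : ∀ {e} r → e ≢ 0ℤ → ∀ p → p *P (e ∷ r) ≐ [] → p ≐ []
  no-zero-divisors-∷     r e≢0 []      _          = ≐-refl
  no-zero-divisors-∷ {e} r e≢0 (a ∷ p) p[e∷r]≐[]
    with ℤP.i*j≡0⇒i≡0∨j≡0 a (≡.trans (≡.sym (ℤP.+-identityʳ (a * e))) (∷≐[]⇒head≡0 p[e∷r]≐[]))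
  ... | inj₂ e≡0    = ⊥-elim (e≢0 e≡0)
  ... | inj₁ ≡.refl = zero∷-≐[] (no-zero-divisors-∷ r e≢0 p (begin
    p *P (e ∷ r)                     ≈⟨ +P-cong (scale-zero r) ≐-refl ⟨
    map (0ℤ *_) r +P p *P (e ∷ r)    ≈⟨ ∷≐[]⇒tail≐[] p[e∷r]≐[] ⟩
    []                               ∎))

  no-zero-divisors : ∀ r p → ¬ r ≐ [] → p *P r ≐ [] → p ≐ []
  no-zero-divisors []      p r≉[] _ = ⊥-elim (r≉[] ≐-refl)
  no-zero-divisors (e ∷ r) p r≉[] pr≐[] with e ℤ.≟ 0ℤ
  ... | no  e≢0    = no-zero-divisors-∷ r e≢0 p pr≐[]
  ... | yes ≡.refl = no-zero-divisors r p (r≉[] ∘ zero∷-≐[]) (∷≐[]⇒tail≐[] (begin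
    0ℤ ∷ (p *P r)                       ≈⟨ +P-cong (scale-zero p) ≐-refl ⟨
    map (0ℤ *_) p +P (0ℤ ∷ (p *P r))    ≈⟨ *P-∷ʳ p 0ℤ r ⟨
    p *P (0ℤ ∷ r)                       ≈⟨ pr≐[] ⟩
    []                                  ∎))

  *P-≉[] : ∀ {p r} → ¬ p ≐ [] → ¬ r ≐ [] → ¬ p *P r ≐ []
  *P-≉[] p≉[] r≉[] pr≐[] = p≉[] (no-zero-divisors _ _ r≉[] pr≐[])

  *P-cancelʳ : AlmostRightCancellative _≐_ [] _*P_
  *P-cancelʳ r p s r≉[] pr≐sr = x∙y⁻¹≈ε⇒x≈y p s (no-zero-divisors r (p +P negP s) r≉[] (begin
    (p +P negP s) *P r         ≈⟨ [y-z]x≈yx-zx r p s ⟩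
    p *P r +P negP (s *P r)    ≈⟨ x≈y⇒x∙y⁻¹≈ε pr≐sr ⟩
    []                         ∎))
    where open RingProperties polyRing.ring using ([y-z]x≈yx-zx; x∙y⁻¹≈ε⇒x≈y; x≈y⇒x∙y⁻¹≈ε)

  Xᵖ-+ : ∀ m n → Xᵖ (m ℕ.+ n) ≐ Xᵖ m *P Xᵖ n
  Xᵖ-+ zero    n = ≐-sym (*P-identityˡ (Xᵖ n))
  Xᵖ-+ (suc m) n = ≐-trans (∷-cong ≡.refl (Xᵖ-+ m n)) (≐-sym (zero∷-*P (Xᵖ m) (Xᵖ n)))

  coeff-Xᵖ : ∀ n → coeff (Xᵖ n) n ≡ 1ℤ
  coeff-Xᵖ zero    = ≡.refl
  coeff-Xᵖ (suc n) = coeff-Xᵖ n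

  Xᵖ≉[] : ∀ n → ¬ Xᵖ n ≐ []
  Xᵖ≉[] n Xᵖn≐[] with ≡.trans (≡.sym (coeff-Xᵖ n)) (coeff-≡ Xᵖn≐[] n)
  ... | ()

  oneP≉[] : ¬ oneP ≐ []
  oneP≉[] = Xᵖ≉[] 0

  1-Xᵖ≉[] : ∀ n → ¬ oneP +P negP (Xᵖ (suc n)) ≐ []
  1-Xᵖ≉[] n e with ∷≐[]⇒head≡0 e
  ... | ()

  Xᵖ-1≉[] : ∀ n → ¬ Xᵖ (suc n) +P negP oneP ≐ []
  Xᵖ-1≉[] n e with ∷≐[]⇒head≡0 e
  ... | ()

module FractionField where
  open Polynomial

  record Fraction : Set where
    field
      numer denom : Poly
      denom≉[]    : ¬ denom ≐ []
  open Fraction public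

  infix 4 _≃_
  record _≃_ (x y : Fraction) : Set where
    constructor cross
    field ≃-cross : numer x *P denom y ≐ numer y *P denom x

  fraction : (f : Frac) → ¬ den f ≐ [] → Fraction
  fraction f den≉[] = record { numer = num f ; denom = den f ; denom≉[] = den≉[] }

  toFrac : Fraction → Frac
  toFrac x = numer x / denom x

  -- The operations are those of Frac, so toFrac commutes with them definitionally.
  infixl 6 _⊕_
  infixl 7 _⊛_
  _⊕_ _⊛_ : Fraction → Fraction → Fraction
  x ⊕ y = record { numer    = numer x *P denom y +P numer y *P denom x
                 ; denom    = denom x *P denom y
                 ; denom≉[] = *P-≉[] (denom≉[] x) (denom≉[] y) }
  x ⊛ y = record { numer    = numer x *P numer y
                 ; denom    = denom x *P denom y
                 ; denom≉[] = *P-≉[] (denom≉[] x) (denom≉[] y) }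

  ⊖_ : Fraction → Fraction
  ⊖ x = record { numer = negP (numer x) ; denom = denom x ; denom≉[] = denom≉[] x }

  𝟘 𝟙 : Fraction
  𝟘 = fraction 0F oneP≉[]
  𝟙 = fraction 1F oneP≉[]

  ≃-trans : ∀ {x y z} → x ≃ y → y ≃ z → x ≃ z
  ≃-trans {x} {y} {z} (cross x≃y) (cross y≃z) = cross (*P-cancelʳ d _ _ (denom≉[] y) (begin
    (a *P f) *P d    ≈⟨ xy∙z≈xz∙y a f d ⟩
    (a *P d) *P f    ≈⟨ *P-congˡ f x≃y ⟩
    (c *P b) *P f    ≈⟨ xy∙z≈xz∙y c b f ⟩
    (c *P f) *P b    ≈⟨ *P-congˡ b y≃z ⟩
    (e *P d) *P b    ≈⟨ xy∙z≈xz∙y e d b ⟩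
    (e *P b) *P d    ∎))
    where
    open SetoidReasoning ≐-setoid
    open CommutativeSemigroupProperties polyRing.*-commutativeSemigroup using (xy∙z≈xz∙y)
    a = numer x ; b = denom x ; c = numer y ; d = denom y ; e = numer z ; f = denom z

  ⊕-cong : ∀ {x x′ y y′} → x ≃ x′ → y ≃ y′ → x ⊕ y ≃ x′ ⊕ y′
  ⊕-cong {x} {x′} {y} {y′} (cross x≃x′) (cross y≃y′) = cross (begin
    (a *P d +P c *P b) *P (b′ *P d′)                    ≈⟨ expand a b c d b′ d′ ⟩
    (a *P b′) *P (d′ *P d) +P (c *P d′) *P (b′ *P b)    ≈⟨ +P-cong (*P-congˡ (d′ *P d) x≃x′) (*P-congˡ (b′ *P b) y≃y′) ⟩
    (a′ *P b) *P (d′ *P d) +P (c′ *P d) *P (b′ *P b)    ≈⟨ collect a′ b′ c′ d′ b d ⟩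
    (a′ *P d′ +P c′ *P b′) *P (b *P d)                  ∎)
    where
    open SetoidReasoning ≐-setoid
    a = numer x ; b = denom x ; c = numer y ; d = denom y
    a′ = numer x′ ; b′ = denom x′ ; c′ = numer y′ ; d′ = denom y′
    expand : ∀ a b c d b′ d′ → (a *P d +P c *P b) *P (b′ *P d′) ≐ (a *P b′) *P (d′ *P d) +P (c *P d′) *P (b′ *P b)
    expand = solve-∀ polySolverRing
    collect : ∀ a b c d b′ d′ → (a *P b′) *P (d *P d′) +P (c *P d′) *P (b *P b′) ≐ (a *P d +P c *P b) *P (b′ *P d′)
    collect = solve-∀ polySolverRing

  ⊛-cong : ∀ {x x′ y y′} → x ≃ x′ → y ≃ y′ → x ⊛ y ≃ x′ ⊛ y′
  ⊛-cong {x} {x′} {y} {y′} (cross x≃x′) (cross y≃y′) = cross (begin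
    (a *P c) *P (b′ *P d′)    ≈⟨ interchange a c b′ d′ ⟩
    (a *P b′) *P (c *P d′)    ≈⟨ polyRing.*-cong x≃x′ y≃y′ ⟩
    (a′ *P b) *P (c′ *P d)    ≈⟨ interchange a′ c′ b d ⟨
    (a′ *P c′) *P (b *P d)    ∎)
    where
    open SetoidReasoning ≐-setoid
    open CommutativeSemigroupProperties polyRing.*-commutativeSemigroup using (interchange)
    a = numer x ; b = denom x ; c = numer y ; d = denom y
    a′ = numer x′ ; b′ = denom x′ ; c′ = numer y′ ; d′ = denom y′

  ⊖-cong : ∀ {x y} → x ≃ y → ⊖ x ≃ ⊖ y
  ⊖-cong {x} {y} (cross x≃y) = cross (begin
    negP (numer x) *P denom y    ≈⟨ -‿distribˡ-* (numer x) (denom y) ⟨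
    negP (numer x *P denom y)    ≈⟨ negP-cong x≃y ⟩
    negP (numer y *P denom x)    ≈⟨ -‿distribˡ-* (numer y) (denom x) ⟩
    negP (numer y) *P denom x    ∎)
    where
    open SetoidReasoning ≐-setoid
    open RingProperties polyRing.ring using (-‿distribˡ-*)

  ⊕-assoc : ∀ x y z → (x ⊕ y) ⊕ z ≃ x ⊕ (y ⊕ z)
  ⊕-assoc x y z = cross (identity (numer x) (denom x) (numer y) (denom y) (numer z) (denom z))
    where
    identity : ∀ a b c d e f → ((a *P d +P c *P b) *P f +P e *P (b *P d)) *P (b *P (d *P f))
                             ≐ (a *P (d *P f) +P (c *P f +P e *P d) *P b) *P ((b *P d) *P f)
    identity = solve-∀ polySolverRing

  ⊕-comm : ∀ x y → x ⊕ y ≃ y ⊕ x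
  ⊕-comm x y = cross (identity (numer x) (denom x) (numer y) (denom y))
    where
    identity : ∀ a b c d → (a *P d +P c *P b) *P (d *P b) ≐ (c *P b +P a *P d) *P (b *P d)
    identity = solve-∀ polySolverRing

  ⊕-identityˡ : ∀ x → 𝟘 ⊕ x ≃ x
  ⊕-identityˡ x = cross (identity (numer x) (denom x))
    where
    identity : ∀ a b → ([] *P b +P a *P oneP) *P b ≐ a *P (oneP *P b)
    identity = solve-∀ polySolverRing

  ⊕-identityʳ : ∀ x → x ⊕ 𝟘 ≃ x
  ⊕-identityʳ x = cross (identity (numer x) (denom x))
    where
    identity : ∀ a b → (a *P oneP +P [] *P b) *P b ≐ a *P (b *P oneP)
    identity = solve-∀ polySolverRing

  ⊖-inverseˡ : ∀ x → ⊖ x ⊕ x ≃ 𝟘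
  ⊖-inverseˡ x = cross (identity (numer x) (denom x))
    where
    identity : ∀ a b → (negP a *P b +P a *P b) *P oneP ≐ [] *P (b *P b)
    identity = solve-∀ polySolverRing

  ⊖-inverseʳ : ∀ x → x ⊕ ⊖ x ≃ 𝟘
  ⊖-inverseʳ x = cross (identity (numer x) (denom x))
    where
    identity : ∀ a b → (a *P b +P negP a *P b) *P oneP ≐ [] *P (b *P b)
    identity = solve-∀ polySolverRing

  ⊛-assoc : ∀ x y z → (x ⊛ y) ⊛ z ≃ x ⊛ (y ⊛ z)
  ⊛-assoc x y z = cross (identity (numer x) (denom x) (numer y) (denom y) (numer z) (denom z))
    where
    identity : ∀ a b c d e f → ((a *P c) *P e) *P (b *P (d *P f)) ≐ (a *P (c *P e)) *P ((b *P d) *P f)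
    identity = solve-∀ polySolverRing

  ⊛-comm : ∀ x y → x ⊛ y ≃ y ⊛ x
  ⊛-comm x y = cross (identity (numer x) (denom x) (numer y) (denom y))
    where
    identity : ∀ a b c d → (a *P c) *P (d *P b) ≐ (c *P a) *P (b *P d)
    identity = solve-∀ polySolverRing

  ⊛-identityˡ : ∀ x → 𝟙 ⊛ x ≃ x
  ⊛-identityˡ x = cross (identity (numer x) (denom x))
    where
    identity : ∀ a b → (oneP *P a) *P b ≐ a *P (oneP *P b)
    identity = solve-∀ polySolverRing

  ⊛-identityʳ : ∀ x → x ⊛ 𝟙 ≃ x
  ⊛-identityʳ x = cross (identity (numer x) (denom x))
    where
    identity : ∀ a b → (a *P oneP) *P b ≐ a *P (b *P oneP)
    identity = solve-∀ polySolverRing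

  ⊛-distribˡ : ∀ x y z → x ⊛ (y ⊕ z) ≃ x ⊛ y ⊕ x ⊛ z
  ⊛-distribˡ x y z = cross (identity (numer x) (denom x) (numer y) (denom y) (numer z) (denom z))
    where
    identity : ∀ a b c d e f → (a *P (c *P f +P e *P d)) *P ((b *P d) *P (b *P f))
                             ≐ ((a *P c) *P (b *P f) +P (a *P e) *P (b *P d)) *P (b *P (d *P f))
    identity = solve-∀ polySolverRing

  ⊛-distribʳ : ∀ x y z → (y ⊕ z) ⊛ x ≃ y ⊛ x ⊕ z ⊛ x
  ⊛-distribʳ x y z = cross (identity (numer x) (denom x) (numer y) (denom y) (numer z) (denom z))
    where
    identity : ∀ a b c d e f → ((c *P f +P e *P d) *P a) *P ((d *P b) *P (f *P b))
                             ≐ ((c *P a) *P (f *P b) +P (e *P a) *P (d *P b)) *P ((d *P f) *P b)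
    identity = solve-∀ polySolverRing

  fractionField : CommutativeRing 0ℓ 0ℓ
  fractionField = record
    { Carrier = Fraction ; _≈_ = _≃_ ; _+_ = _⊕_ ; _*_ = _⊛_ ; -_ = ⊖_ ; 0# = 𝟘 ; 1# = 𝟙
    ; isCommutativeRing = record
      { isRing = record
        { +-isAbelianGroup = record
          { isGroup = record
            { isMonoid = record
              { isSemigroup = record
                { isMagma = record
                  { isEquivalence = record
                    { refl = cross ≐-refl ; sym = λ (cross e) → cross (≐-sym e) ; trans = ≃-trans }
                  ; ∙-cong = ⊕-cong
                  }
                ; assoc = ⊕-assoc
                }
              ; identity = ⊕-identityˡ , ⊕-identityʳ
              }
            ; inverse = ⊖-inverseˡ , ⊖-inverseʳ
            ; ⁻¹-cong = ⊖-cong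
            }
          ; comm = ⊕-comm
          }
        ; *-cong     = ⊛-cong
        ; *-assoc    = ⊛-assoc
        ; *-identity = ⊛-identityˡ , ⊛-identityʳ
        ; distrib    = ⊛-distribˡ , ⊛-distribʳ
        }
      ; *-comm = ⊛-comm
      }
    }

  toFrac-≡⇒≃ : ∀ {x y} → toFrac x ≡ toFrac y → x ≃ y
  toFrac-≡⇒≃ ≡.refl = cross ≐-refl

  ≃⇒≈F : ∀ {x y} → x ≃ y → toFrac x ≈F toFrac y
  ≃⇒≈F (cross x≃y) = ≐[]⇒IsZeroP (x≈y⇒x∙y⁻¹≈ε x≃y)
    where open RingProperties polyRing.ring using (x≈y⇒x∙y⁻¹≈ε)

  open Sums fractionField using (∑)

  toFrac-∑ : ∀ n f → toFrac (∑ n f) ≡ sumF n (toFrac ∘ f)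
  toFrac-∑ zero    f = ≡.refl
  toFrac-∑ (suc n) f = ≡.cong (_+F toFrac (f n)) (toFrac-∑ n f)

  invF-inverse : ∀ f nz nz′ → fraction (invF f) nz ⊛ fraction f nz′ ≃ 𝟙
  invF-inverse f _ _ = cross (identity (num f) (den f))
    where
    identity : ∀ n d → (d *P n) *P oneP ≐ oneP *P (n *P d)
    identity = solve-∀ polySolverRing

module QBinomial where
  open Polynomial
  open FractionField

  negProd-num≉[] : ∀ N → ¬ num (negProd N) ≐ []
  negProd-num≉[] zero    = oneP≉[]
  negProd-num≉[] (suc N) = *P-≉[] (negProd-num≉[] N) (Xᵖ-1≉[] N)

  negProd-den≉[] : ∀ N → ¬ den (negProd N) ≐ []
  negProd-den≉[] zero    = oneP≉[]
  negProd-den≉[] (suc N) = *P-≉[] (negProd-den≉[] N) (Xᵖ≉[] (suc N))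

  posProd-num≉[] : ∀ n → ¬ num (posProd n) ≐ []
  posProd-num≉[] zero    = oneP≉[]
  posProd-num≉[] (suc n) = *P-≉[] (posProd-num≉[] n) (1-Xᵖ≉[] n)

  posProd-den≉[] : ∀ n → ¬ den (posProd n) ≐ []
  posProd-den≉[] zero    = oneP≉[]
  posProd-den≉[] (suc n) = *P-≉[] (posProd-den≉[] n) oneP≉[]

  reg-num≉[] : ∀ n → ¬ num (reg n) ≐ []
  reg-num≉[] (+ n)    = posProd-num≉[] n
  reg-num≉[] -[1+ N ] = negProd-den≉[] N

  reg-den≉[] : ∀ n → ¬ den (reg n) ≐ []
  reg-den≉[] (+ n)    = posProd-den≉[] n
  reg-den≉[] -[1+ N ] = negProd-num≉[] N

  qbinom-den≉[] : ∀ n k → ¬ den (qbinom n k) ≐ []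
  qbinom-den≉[] n k with does (pole n ℕ.≟ (pole k ℕ.+ pole (n ℤ.- k)))
  ... | true  = *P-≉[] (reg-den≉[] n) (*P-≉[] (reg-num≉[] k) (reg-num≉[] (n ℤ.- k)))
  ... | false = oneP≉[]

  qpow-den≉[] : ∀ e → ¬ den (qpow e) ≐ []
  qpow-den≉[] (+ n)    = oneP≉[]
  qpow-den≉[] -[1+ n ] = Xᵖ≉[] (suc n)

  q^_ : ℤ → Fraction
  q^ e = fraction (qpow e) (qpow-den≉[] e)

  qbinomᶠ : ℤ → ℤ → Fraction
  qbinomᶠ n k = fraction (qbinom n k) (qbinom-den≉[] n k)

  B : ℕ → ℕ → Fraction
  B b N = qbinomᶠ -[1+ b ] -[1+ N ]

  posPart negPart : ℤ → ℕ
  posPart (+ n)    = n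
  posPart -[1+ n ] = 0
  negPart (+ n)    = 0
  negPart -[1+ n ] = suc n

  module _ where
    open ≡.≡-Reasoning

    posPart≡ : ∀ e → + posPart e ≡ e ℤ.+ + negPart e
    posPart≡ (+ n)    = ≡.sym (ℤP.+-identityʳ (+ n))
    posPart≡ -[1+ n ] = ≡.sym (ℤP.n⊖n≡0 (suc n))

    parts-+ : ∀ e f → posPart (e ℤ.+ f) ℕ.+ (negPart e ℕ.+ negPart f) ≡ (posPart e ℕ.+ posPart f) ℕ.+ negPart (e ℤ.+ f)
    parts-+ e f = ℤP.+-injective (begin
      + posPart (e ℤ.+ f) ℤ.+ (+ negPart e ℤ.+ + negPart f)
        ≡⟨ ≡.cong (ℤ._+ (+ negPart e ℤ.+ + negPart f)) (posPart≡ (e ℤ.+ f)) ⟩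
      (e ℤ.+ f ℤ.+ + negPart (e ℤ.+ f)) ℤ.+ (+ negPart e ℤ.+ + negPart f)
        ≡⟨ identity e f (+ negPart e) (+ negPart f) (+ negPart (e ℤ.+ f)) ⟩
      ((e ℤ.+ + negPart e) ℤ.+ (f ℤ.+ + negPart f)) ℤ.+ + negPart (e ℤ.+ f)
        ≡⟨ ≡.cong₂ (λ x y → (x ℤ.+ y) ℤ.+ + negPart (e ℤ.+ f)) (posPart≡ e) (posPart≡ f) ⟨
      (+ posPart e ℤ.+ + posPart f) ℤ.+ + negPart (e ℤ.+ f)
        ∎)
      where
      identity : ∀ e f m n o → (e ℤ.+ f ℤ.+ o) ℤ.+ (m ℤ.+ n) ≡ ((e ℤ.+ m) ℤ.+ (f ℤ.+ n)) ℤ.+ o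
      identity = solve-ℤ

  monomial : ℕ → ℕ → Fraction
  monomial m n = fraction (Xᵖ m / Xᵖ n) (Xᵖ≉[] n)

  monomial-cong : ∀ {m n m′ n′} → m ℕ.+ n′ ≡ m′ ℕ.+ n → monomial m n ≃ monomial m′ n′
  monomial-cong {m} {n} {m′} {n′} m+n′≡m′+n =
    cross (≐-trans (≐-sym (Xᵖ-+ m n′)) (≐-trans (≐-reflexive (≡.cong Xᵖ m+n′≡m′+n)) (Xᵖ-+ m′ n)))

  monomial-⊛ : ∀ m n m′ n′ → monomial (m ℕ.+ m′) (n ℕ.+ n′) ≃ monomial m n ⊛ monomial m′ n′
  monomial-⊛ m n m′ n′ = cross (polyRing.*-cong (Xᵖ-+ m m′) (≐-sym (Xᵖ-+ n n′)))

  q^≃monomial : ∀ e → q^ e ≃ monomial (posPart e) (negPart e)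
  q^≃monomial (+ n)    = cross ≐-refl
  q^≃monomial -[1+ n ] = cross ≐-refl

  negStepFrac posStepFrac : ℕ → Frac
  negStepFrac N = (Xᵖ (suc N) +P negP oneP) / Xᵖ (suc N)
  posStepFrac n = fromPoly (oneP +P negP (Xᵖ (suc n)))

  negStep negStep⁻¹ posStep posStep⁻¹ negProdᶠ negProdᶠ⁻¹ posProdᶠ⁻¹ : ℕ → Fraction
  negStep    N = fraction (negStepFrac N) (Xᵖ≉[] (suc N))
  negStep⁻¹  N = fraction (invF (negStepFrac N)) (Xᵖ-1≉[] N)
  posStep    n = fraction (posStepFrac n) oneP≉[]
  posStep⁻¹  n = fraction (invF (posStepFrac n)) (1-Xᵖ≉[] n)
  negProdᶠ   N = fraction (negProd N) (negProd-den≉[] N)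
  negProdᶠ⁻¹ N = fraction (invF (negProd N)) (negProd-num≉[] N)
  posProdᶠ⁻¹ n = fraction (invF (posProd n)) (posProd-num≉[] n)

  -- qbinom with n - k abstracted, so that the pole test computes once d is in normal form.
  qbinom-gap : ∀ {n k d} → n ℤ.- k ≡ d →
               qbinom n k ≡ (if does (pole n ℕ.≟ pole k ℕ.+ pole d) then reg n *F invF (reg k *F reg d) else 0F)
  qbinom-gap ≡.refl = ≡.refl

  B-vanish : ∀ {b N} → N < b → B b N ≃ 𝟘
  B-vanish {b} {N} N<b with ℕP.m≤n⇒∃[o]m+o≡n N<b
  ... | k , ≡.refl = toFrac-≡⇒≃ {B b N} {𝟘} (qbinom-gap { -[1+ b ]} { -[1+ N ]}
                       (≡.trans (-[1+m]-[-[1+n]]≡n-m b N) (identity (+ N) (+ k))))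
    where
    identity : ∀ N K → N ℤ.- (1ℤ ℤ.+ (N ℤ.+ K)) ≡ ℤ.- (1ℤ ℤ.+ K)
    identity = solve-ℤ

  B-formula : ∀ b k {N} → b ℕ.+ k ≡ N → B b N ≃ negProdᶠ⁻¹ b ⊛ (negProdᶠ N ⊛ posProdᶠ⁻¹ k)
  B-formula b k ≡.refl = toFrac-≡⇒≃ {B b (b ℕ.+ k)} (qbinom-gap { -[1+ b ]} { -[1+ b ℕ.+ k ]}
                           (≡.trans (-[1+m]-[-[1+n]]≡n-m b (b ℕ.+ k)) (identity (+ b) (+ k))))
    where
    identity : ∀ B K → (B ℤ.+ K) ℤ.- B ≡ K
    identity = solve-ℤ

  B-diag : ∀ b → B b b ≃ 𝟙
  B-diag b = ≃-trans (B-formula b 0 (ℕP.+-identityʳ b)) (cross (identity (num (negProd b)) (den (negProd b))))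
    where
    identity : ∀ n d → (d *P (n *P oneP)) *P oneP ≐ oneP *P (n *P (d *P oneP))
    identity = solve-∀ polySolverRing

  negStep-shift : ∀ b k → negStep (suc (b ℕ.+ k)) ≃ q^ -[1+ k ] ⊛ (negStep b ⊕ ⊖ posStep k)
  negStep-shift b k = cross (begin
    (Xₘ +P negP oneP) *P (Xₖ *P (Xᵦ *P oneP))
      ≈⟨ *P-congˡ (Xₖ *P (Xᵦ *P oneP)) (+P-cong {Xₘ} {Xᵦ *P Xₖ} {negP oneP} Xₘ≐XᵦXₖ ≐-refl) ⟩
    (Xᵦ *P Xₖ +P negP oneP) *P (Xₖ *P (Xᵦ *P oneP))
      ≈⟨ identity Xᵦ Xₖ ⟩
    N *P (Xᵦ *P Xₖ)
      ≈⟨ *P-congʳ N Xₘ≐XᵦXₖ ⟨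
    N *P Xₘ
      ∎)
    where
    open SetoidReasoning ≐-setoid
    Xᵦ = Xᵖ (suc b)
    Xₖ = Xᵖ (suc k)
    Xₘ = Xᵖ (suc (suc (b ℕ.+ k)))
    N  = oneP *P ((Xᵦ +P negP oneP) *P oneP +P negP (oneP +P negP Xₖ) *P Xᵦ)
    Xₘ≐XᵦXₖ : Xₘ ≐ Xᵦ *P Xₖ
    Xₘ≐XᵦXₖ = ≐-trans (≐-reflexive (≡.cong (Xᵖ ∘ suc) (≡.sym (ℕP.+-suc b k)))) (Xᵖ-+ (suc b) (suc k))
    identity : ∀ Xᵦ Xₖ → (Xᵦ *P Xₖ +P negP oneP) *P (Xₖ *P (Xᵦ *P oneP))
                      ≐ (oneP *P ((Xᵦ +P negP oneP) *P oneP +P negP (oneP +P negP Xₖ) *P Xᵦ)) *P (Xᵦ *P Xₖ)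
    identity = solve-∀ polySolverRing

  negStep≃-[q^⊛posStep] : ∀ N → negStep N ≃ ⊖ (q^ -[1+ N ] ⊛ posStep N)
  negStep≃-[q^⊛posStep] N = cross (identity (Xᵖ (suc N)))
    where
    identity : ∀ X → (X +P negP oneP) *P (X *P oneP) ≐ negP (oneP *P (oneP +P negP X)) *P X
    identity = solve-∀ polySolverRing

  open CommutativeRing fractionField
    using (setoid; reflexive; trans; *-cong; *-congˡ; +-cong; +-congˡ; -‿cong; _-_;
           zeroʳ; *-identityˡ; +-identityʳ; -‿inverseʳ)
  open SetoidReasoning setoid
  open UnitIdentities fractionField using (pascal-units; pascal-zero-units)
  open RingProperties (CommutativeRing.ring fractionField) using (-0#≈0#)

  q^-homo : ∀ e f → q^ (e ℤ.+ f) ≃ q^ e ⊛ q^ f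
  q^-homo e f = begin
    q^ (e ℤ.+ f)                                                          ≈⟨ q^≃monomial (e ℤ.+ f) ⟩
    monomial (posPart (e ℤ.+ f)) (negPart (e ℤ.+ f))                      ≈⟨ monomial-cong (parts-+ e f) ⟩
    monomial (posPart e ℕ.+ posPart f) (negPart e ℕ.+ negPart f)          ≈⟨ monomial-⊛ (posPart e) (negPart e) _ _ ⟩
    monomial (posPart e) (negPart e) ⊛ monomial (posPart f) (negPart f)   ≈⟨ *-cong (q^≃monomial e) (q^≃monomial f) ⟨
    q^ e ⊛ q^ f                                                           ∎

  B-pascal : ∀ b N → B (suc b) (suc N) ≃ q^ (b ⊖ N) ⊛ (B b N - B (suc b) N)
  B-pascal b N with compare b N
  ... | less b k = begin
    B (suc b) (suc (suc (b ℕ.+ k)))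
      ≈⟨ B-formula (suc b) (suc k) (≡.cong suc (ℕP.+-suc b k)) ⟩
    (a ⊛ y′) ⊛ ((m ⊛ Y) ⊛ (c ⊛ z′))
      ≈⟨ pascal-units {a} {m} {c} {negStep b} {y′} {posStep k} {z′} {q^ -[1+ k ]} {Y}
           (invF-inverse (negStepFrac b) (Xᵖ-1≉[] b) (Xᵖ≉[] (suc b)))
           (invF-inverse (posStepFrac k) (1-Xᵖ≉[] k) oneP≉[])
           (negStep-shift b k) ⟩
    q^ -[1+ k ] ⊛ (a ⊛ (m ⊛ (c ⊛ z′)) - (a ⊛ y′) ⊛ (m ⊛ c))
      ≈⟨ *-cong (reflexive (≡.cong q^_ b⊖suc[b+k]≡-[1+k]))
                (+-cong (B-formula b (suc k) (ℕP.+-suc b k)) (-‿cong (B-formula (suc b) k ≡.refl))) ⟨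
    q^ (b ⊖ suc (b ℕ.+ k)) ⊛ (B b (suc (b ℕ.+ k)) - B (suc b) (suc (b ℕ.+ k)))
      ∎
    where
    a = negProdᶠ⁻¹ b ; y′ = negStep⁻¹ b ; m = negProdᶠ (suc (b ℕ.+ k)) ; Y = negStep (suc (b ℕ.+ k))
    c = posProdᶠ⁻¹ k ; z′ = posStep⁻¹ k
    b⊖suc[b+k]≡-[1+k] : b ⊖ suc (b ℕ.+ k) ≡ -[1+ k ]
    b⊖suc[b+k]≡-[1+k] = ≡.trans (≡.sym (ℤP.m-n≡m⊖n b (suc (b ℕ.+ k)))) (identity (+ b) (+ k))
      where
      identity : ∀ B K → B ℤ.- (1ℤ ℤ.+ (B ℤ.+ K)) ≡ ℤ.- (1ℤ ℤ.+ K)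
      identity = solve-ℤ
  ... | equal b = begin
    B (suc b) (suc b)                    ≈⟨ B-diag (suc b) ⟩
    𝟙                                    ≈⟨ *-identityˡ 𝟙 ⟨
    𝟙 ⊛ 𝟙                                ≈⟨ *-congˡ {𝟙} (trans (+-congˡ {𝟙} -0#≈0#) (+-identityʳ 𝟙)) ⟨
    𝟙 ⊛ (𝟙 - 𝟘)                          ≈⟨ *-cong (reflexive (≡.cong q^_ (ℤP.n⊖n≡0 b)))
                                                   (+-cong (B-diag b) (-‿cong (B-vanish (ℕP.n<1+n b)))) ⟨
    q^ (b ⊖ b) ⊛ (B b b - B (suc b) b)   ∎
  ... | greater N k = begin
    B (suc (suc (N ℕ.+ k))) (suc N)   ≈⟨ B-vanish (s≤s N<suc[N+k]) ⟩
    𝟘                                 ≈⟨ zeroʳ t ⟨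
    t ⊛ 𝟘                             ≈⟨ *-congˡ {t} (-‿inverseʳ 𝟘) ⟨
    t ⊛ (𝟘 - 𝟘)                       ≈⟨ *-congˡ {t} (+-cong (B-vanish N<suc[N+k]) (-‿cong (B-vanish N<suc[suc[N+k]]))) ⟨
    t ⊛ (B (suc (N ℕ.+ k)) N - B (suc (suc (N ℕ.+ k))) N)   ∎
    where
    t = q^ (suc (N ℕ.+ k) ⊖ N)
    N<suc[N+k] : N < suc (N ℕ.+ k)
    N<suc[N+k] = s≤s (ℕP.m≤m+n N k)
    N<suc[suc[N+k]] : N < suc (suc (N ℕ.+ k))
    N<suc[suc[N+k]] = ℕP.m<n⇒m<1+n N<suc[N+k]

  B-zero-suc : ∀ N → B 0 (suc N) ≃ ⊖ (q^ -[1+ N ] ⊛ B 0 N)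
  B-zero-suc N = begin
    B 0 (suc N)                        ≈⟨ B-formula 0 (suc N) ≡.refl ⟩
    a ⊛ ((m ⊛ Y) ⊛ (c ⊛ z′))           ≈⟨ pascal-zero-units {a} {m} {c} {posStep N} {z′} {q^ -[1+ N ]} {Y}
                                            (invF-inverse (posStepFrac N) (1-Xᵖ≉[] N) oneP≉[])
                                            (negStep≃-[q^⊛posStep] N) ⟩
    ⊖ (q^ -[1+ N ] ⊛ (a ⊛ (m ⊛ c)))    ≈⟨ -‿cong (*-congˡ {q^ -[1+ N ]} (B-formula 0 N ≡.refl)) ⟨
    ⊖ (q^ -[1+ N ] ⊛ B 0 N)            ∎
    where
    a = negProdᶠ⁻¹ 0 ; m = negProdᶠ N ; Y = negStep N ; c = posProdᶠ⁻¹ N ; z′ = posStep⁻¹ N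

  negativeQBinomial : NegativeQBinomial fractionField
  negativeQBinomial = record
    { q^_         = q^_
    ; q^-homo     = q^-homo
    ; B           = B
    ; B-zero-zero = B-diag 0
    ; B-suc-zero  = λ b → B-vanish {suc b} (s≤s z≤n)
    ; B-zero-suc  = B-zero-suc
    ; B-pascal    = B-pascal
    }

  -[1+c]-[-[1+i]]≡-[1+c∸suc[i]] : ∀ {c i} → i < c → -[1+ c ] ℤ.- -[1+ i ] ≡ -[1+ c ∸ suc i ]
  -[1+c]-[-[1+i]]≡-[1+c∸suc[i]] {c} {i} i<c with ℕP.m≤n⇒∃[o]m+o≡n i<c
  ... | j , ≡.refl = ≡.trans (-[1+m]-[-[1+n]]≡n-m (suc (i ℕ.+ j)) i)
                       (≡.trans (identity (+ i) (+ j)) (≡.cong -[1+_] (≡.sym (ℕP.m+n∸m≡n i j))))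
    where
    identity : ∀ I J → I ℤ.- (1ℤ ℤ.+ (I ℤ.+ J)) ≡ ℤ.- (1ℤ ℤ.+ J)
    identity = solve-ℤ

open import Data.Integer using (_+_; _-_; _*_)

lemma4p9 : (a b c : ℕ) →
    sumF c (λ i → qpow ((-[1+ c ] - -[1+ i ]) * (-[1+ a ] - -[1+ i ]))
                    *F qbinom -[1+ a ] -[1+ i ]
                    *F qbinom -[1+ b ] (-[1+ c ] - -[1+ i ]))
      ≈F qbinom (-[1+ a ] + -[1+ b ]) -[1+ c ]
lemma4p9 a b c = ≡.subst (_≈F toFrac (B (suc (a ℕ.+ b)) c)) (toFrac-∑ c summand) (≃⇒≈F (begin
    ∑ c summand          ≈⟨ ∑-cong c (λ i i<c → reflexive (≡.cong (summand′ i) (-[1+c]-[-[1+i]]≡-[1+c∸suc[i]] i<c))) ⟩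
    ∑ c (term a b c)     ≈⟨ vandermonde a b c ⟩
    B (suc (a ℕ.+ b)) c  ∎))
  where
  open QBinomial
  open FractionField
  open CommutativeRing fractionField using (setoid; reflexive)
  open SetoidReasoning setoid
  open Sums fractionField using (∑; ∑-cong)
  open NegativeVandermonde negativeQBinomial using (term; vandermonde)
  summand′ : ℕ → ℤ → Fraction
  summand′ i k = q^ (weight a c i) ⊛ B a i ⊛ qbinomᶠ -[1+ b ] k
  summand : ℕ → Fraction
  summand i = summand′ i (-[1+ c ] - -[1+ i ])
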